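{- Let $p$ be a prime and $\ell$ a positive integer. Write \[ \mathbf{g}_p(X_1^{\ell}, X_2^{\ell}, \ldots) = \sum_{|\lambda| = p\ell} c_{\lambda}\, \mathbf{e}_{\lambda}(X_1, X_2, \ldots) \] with integers $c_\lambda$, the sum running over partitions $\lambda$ of $p\ell$. Then $c_{(1,1,\ldots,1)} = 0$.
   Context: Symmetric polynomials are in countably many variables $X_1,X_2,\ldots$ with integer coefficients. $\mathbf{g}_p(X_1,X_2,\ldots) = \frac{1}{p}\left( \left(\sum_i X_i\right)^p - \sum_i X_i^p\right)$ (which has integer coefficients). A partition $\lambda=(\lambda_1,\ldots,\lambda_r)$ is a weakly decreasing sequence of positive integers with $|\lambda|=\sum\lambda_s$; $\mathbf{e}_m$ is the elementary symmetric polynomial of degree $m$ and $\mathbf{e}_\lambda=\prod_s \mathbf{e}_{\lambda_s}$. The $\mathbf{e}_\lambda$ form a $\mathbb{Z}$-basis of the symmetric polynomials with integer coefficients, so the $c_\lambda$ are uniquely determined. -}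

module Defs where

open import Data.Nat as ℕ using (ℕ; zero; suc; _∸_; _⊓_)
open import Data.Integer as ℤ using (ℤ; +_)
open import Data.Integer.DivMod using (_/ℕ_)
open import Data.Fin using (Fin)
open import Data.Vec as Vec using (Vec; []; _∷_)
open import Data.Vec.Properties using (≡-dec)
open import Data.List as List using (List; []; _∷_; [_]; concatMap; map; foldr; upTo; allFin)
open import Data.Bool using (Bool; true; false; _∧_; if_then_else_)
open import Relation.Nullary.Decidable using (does)

-- Formal power series (containing the polynomials) over ℤ in N variables
-- X_0 … X_{N-1}: a series is its coefficient function on exponent vectors.

Mon : ℕ → Set
Mon N = Vec ℕ N

Ser : ℕ → Set
Ser N = Mon N → ℤ

below : ∀ {N} → Mon N → List (Mon N)
below []       = [ [] ]
below (m ∷ ms) = concatMap (λ a → map (a ∷_) (below ms)) (upTo (suc m))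

infixl 6 _⊕_ _⊖_
infixl 7 _⊛_ _·_

_⊕_ : ∀ {N} → Ser N → Ser N → Ser N
(f ⊕ g) m = f m ℤ.+ g m

_⊖_ : ∀ {N} → Ser N → Ser N → Ser N
(f ⊖ g) m = f m ℤ.- g m

_·_ : ∀ {N} → ℤ → Ser N → Ser N
(c · f) m = c ℤ.* f m

_⊛_ : ∀ {N} → Ser N → Ser N → Ser N
(f ⊛ g) m = foldr ℤ._+_ (+ 0) (map (λ a → f a ℤ.* g (Vec.zipWith _∸_ m a)) (below m))

𝟘 : ∀ {N} → Ser N
𝟘 _ = + 0

mono : ∀ {N} → Mon N → Ser N
mono e m = if does (≡-dec ℕ._≟_ m e) then + 1 else + 0

𝟙 : ∀ {N} → Ser N
𝟙 = mono (Vec.replicate _ 0)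

X : ∀ {N} → Fin N → Ser N
X {N} i = mono (Vec.updateAt (Vec.replicate N 0) i (λ _ → 1))

_^_ : ∀ {N} → Ser N → ℕ → Ser N
f ^ zero  = 𝟙
f ^ suc k = f ⊛ (f ^ k)

sumVars : ∀ {N} → (Fin N → Ser N) → Ser N
sumVars {N} F = foldr _⊕_ 𝟘 (map F (allFin N))

powerSum : ∀ N → ℕ → Ser N
powerSum N k = sumVars (λ i → X i ^ k)

divBy : ∀ {N} → Ser N → ℕ → Ser N
divBy f zero    = f
divBy f (suc d) m = f m /ℕ suc d

-- g_p(X_1^ℓ, …, X_N^ℓ) = (1/p)((Σ_i X_i^ℓ)^p − Σ_i X_i^{pℓ})
gpℓ : ∀ N (p ℓ : ℕ) → Ser N
gpℓ N p ℓ = divBy (powerSum N ℓ ^ p ⊖ powerSum N (p ℕ.* ℓ)) p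

isSqfreeOfDeg : ∀ {N} → ℕ → Mon N → Bool
isSqfreeOfDeg k m = Vec.foldr _ (λ a b → does (a ℕ.≤? 1) ∧ b) true m ∧ does (Vec.sum m ℕ.≟ k)

e : ∀ {N} → ℕ → Ser N
e k m = if isSqfreeOfDeg k m then + 1 else + 0

eP : ∀ {N} → List ℕ → Ser N
eP λs = foldr (λ k f → e k ⊛ f) 𝟙 λs

-- Partitions, as weakly decreasing lists of positive parts.
-- parts fuel n k : all partitions of n with all parts ≤ k (fuel ≥ n suffices)
parts : ℕ → ℕ → ℕ → List (List ℕ)
parts _        zero    _ = [ [] ]
parts zero     (suc n) _ = []
parts (suc f)  (suc n) k =
  concatMap (λ j → map (j ∷_) (parts f (suc n ∸ j) j)) (map suc (upTo (k ⊓ suc n)))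

partitions : ℕ → List (List ℕ)
partitions n = parts n n n

sumPartitions : ∀ N → ℕ → (List ℕ → ℤ) → Ser N
sumPartitions N n c = foldr _⊕_ 𝟘 (map (λ λs → c λs · eP λs) (partitions n))

-- Put a single variable x (X₂ = X₃ = … = 0).  Then gₚ(x^ℓ) = ((x^ℓ)^p − x^{pℓ})/p = 0, while
-- e₁ = x and eₖ = 0 for k ≥ 2, so e_λ = 0 unless λ = (1,…,1), in which case e_λ = x^{pℓ}.
-- Comparing coefficients of x^{pℓ} gives c_{(1,…,1)} = 0.
module Submission where

open import Defs
open import Data.Nat using (ℕ; _*_; _>_)
open import Data.Nat.Primality using (Prime)
open import Data.Integer using (ℤ; +_)
open import Data.List using (List; replicate)
open import Relation.Binary.PropositionalEquality using (_≡_)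

open import Data.Nat as ℕ using (zero; suc; _∸_; _⊓_; _≤_; z≤n; s≤s)
open import Data.Nat.Properties using (≤-refl)
open import Data.Integer as ℤ using (_+_)
open import Data.Integer.Properties using (+-identityˡ; +-identityʳ; +-assoc; +-inverseʳ; *-identityˡ; *-identityʳ; *-zeroˡ; *-zeroʳ)
open import Data.List using ([]; _∷_; [_]; _++_; map; foldr; concatMap; upTo)
open import Data.List.Properties using (map-upTo)
open import Data.List.Relation.Unary.Any using (Any; here; there)
open import Data.Fin as Fin using ()
open import Data.Vec using ([]; _∷_; zipWith)
open import Function using (_∘_)
open import Relation.Binary.PropositionalEquality using (_≗_; refl; sym; trans; cong; cong₂; module ≡-Reasoning)
open ≡-Reasoning

private variable
  A B : Set

Σ : List A → (A → ℤ) → ℤ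
Σ xs g = foldr _+_ (+ 0) (map g xs)

Σ-cong : ∀ (xs : List A) {g h : A → ℤ} → g ≗ h → Σ xs g ≡ Σ xs h
Σ-cong []       g≗h = refl
Σ-cong (x ∷ xs) g≗h = cong₂ _+_ (g≗h x) (Σ-cong xs g≗h)

Σ-zero : ∀ (xs : List A) {g : A → ℤ} → (∀ x → g x ≡ + 0) → Σ xs g ≡ + 0
Σ-zero []       g≗0 = refl
Σ-zero (x ∷ xs) g≗0 = cong₂ _+_ (g≗0 x) (Σ-zero xs g≗0)

Σ-++ : ∀ (xs ys : List A) (g : A → ℤ) → Σ (xs ++ ys) g ≡ Σ xs g + Σ ys g
Σ-++ []       ys g = sym (+-identityˡ (Σ ys g))
Σ-++ (x ∷ xs) ys g = trans (cong (ℤ._+_ (g x)) (Σ-++ xs ys g)) (sym (+-assoc (g x) (Σ xs g) (Σ ys g)))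

Σ-map : ∀ (f : A → B) (xs : List A) (g : B → ℤ) → Σ (map f xs) g ≡ Σ xs (g ∘ f)
Σ-map f []       g = refl
Σ-map f (x ∷ xs) g = cong (ℤ._+_ (g (f x))) (Σ-map f xs g)

Σ-concatMap : ∀ (f : A → List B) (xs : List A) (g : B → ℤ) →
              Σ (concatMap f xs) g ≡ Σ xs (λ x → Σ (f x) g)
Σ-concatMap f []       g = refl
Σ-concatMap f (x ∷ xs) g =
  trans (Σ-++ (f x) (concatMap f xs) g) (cong (ℤ._+_ (Σ (f x) g)) (Σ-concatMap f xs g))

Σ-upTo-suc : ∀ m (g : ℕ → ℤ) → Σ (upTo (suc m)) g ≡ g 0 + Σ (upTo m) (g ∘ suc)
Σ-upTo-suc m g =
  cong (ℤ._+_ (g 0)) (trans (cong (λ xs → Σ xs g) (sym (map-upTo suc m))) (Σ-map suc (upTo m) g))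

coeff-foldr-⊕ : ∀ {N} (F : A → Ser N) (xs : List A) (m : Mon N) →
                foldr _⊕_ 𝟘 (map F xs) m ≡ Σ xs (λ x → F x m)
coeff-foldr-⊕ F []       m = refl
coeff-foldr-⊕ F (x ∷ xs) m = cong (ℤ._+_ (F x m)) (coeff-foldr-⊕ F xs m)

⊛-zeroˡ : ∀ {N} {f : Ser N} (g : Ser N) → f ≗ 𝟘 → f ⊛ g ≗ 𝟘
⊛-zeroˡ g f≗0 m = Σ-zero (below m) λ a →
  trans (cong (ℤ._* g (zipWith _∸_ m a)) (f≗0 a)) (*-zeroˡ (g (zipWith _∸_ m a)))

⊛-zeroʳ : ∀ {N} (f : Ser N) {g : Ser N} → g ≗ 𝟘 → f ⊛ g ≗ 𝟘
⊛-zeroʳ f g≗0 m = Σ-zero (below m) λ a →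
  trans (cong (f a ℤ.*_) (g≗0 (zipWith _∸_ m a))) (*-zeroʳ (f a))

divBy-𝟘 : ∀ {N} {f : Ser N} → f ≗ 𝟘 → ∀ d → divBy f d ≗ 𝟘
divBy-𝟘 f≗0 zero    m = f≗0 m
divBy-𝟘 f≗0 (suc d) m = cong (ℤ._/ℕ suc d) (f≗0 m)

-- Series in one variable x: δ a b is the coefficient of x^b in x^a.

δ : ℕ → ℕ → ℤ
δ zero    zero    = + 1
δ zero    (suc _) = + 0
δ (suc _) zero    = + 0
δ (suc a) (suc b) = δ a b

δ-refl : ∀ n → δ n n ≡ + 1
δ-refl zero    = refl
δ-refl (suc n) = δ-refl n

infix 4 _≗x^_

record _≗x^_ (f : Ser 1) (a : ℕ) : Set where
  constructor coeffs
  field coeff : ∀ b → f (b ∷ []) ≡ δ a b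

open _≗x^_

coeff-⊛ : (f g : Ser 1) (m : ℕ) →
          (f ⊛ g) (m ∷ []) ≡ Σ (upTo (suc m)) (λ i → f (i ∷ []) ℤ.* g ((m ∸ i) ∷ []))
coeff-⊛ f g m = trans (Σ-concatMap (λ a → map (a ∷_) [ [] ]) (upTo (suc m)) term)
                      (Σ-cong (upTo (suc m)) (λ i → +-identityʳ (term (i ∷ []))))
  where
  term : Mon 1 → ℤ
  term a = f a ℤ.* g (zipWith _∸_ (m ∷ []) a)

Σ-δ-convolution : ∀ a b m → Σ (upTo (suc m)) (λ i → δ a i ℤ.* δ b (m ∸ i)) ≡ δ (a ℕ.+ b) m
Σ-δ-convolution zero b m = begin
  Σ (upTo (suc m)) (λ i → δ 0 i ℤ.* δ b (m ∸ i))
    ≡⟨ Σ-upTo-suc m (λ i → δ 0 i ℤ.* δ b (m ∸ i)) ⟩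
  + 1 ℤ.* δ b m + Σ (upTo m) (λ _ → + 0)
    ≡⟨ cong₂ _+_ (*-identityˡ (δ b m)) (Σ-zero (upTo m) (λ _ → refl)) ⟩
  δ b m + + 0
    ≡⟨ +-identityʳ (δ b m) ⟩
  δ b m ∎
Σ-δ-convolution (suc a) b zero    = refl
Σ-δ-convolution (suc a) b (suc m) = begin
  Σ (upTo (suc (suc m))) (λ i → δ (suc a) i ℤ.* δ b (suc m ∸ i))
    ≡⟨ Σ-upTo-suc (suc m) (λ i → δ (suc a) i ℤ.* δ b (suc m ∸ i)) ⟩
  + 0 + Σ (upTo (suc m)) (λ i → δ a i ℤ.* δ b (m ∸ i))
    ≡⟨ +-identityˡ _ ⟩
  Σ (upTo (suc m)) (λ i → δ a i ℤ.* δ b (m ∸ i))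
    ≡⟨ Σ-δ-convolution a b m ⟩
  δ (suc a ℕ.+ b) (suc m) ∎

⊛-monomial : ∀ {f g a b} → f ≗x^ a → g ≗x^ b → f ⊛ g ≗x^ a ℕ.+ b
⊛-monomial {f} {g} {a} {b} (coeffs f≗xᵃ) (coeffs g≗xᵇ) = coeffs λ m → begin
  (f ⊛ g) (m ∷ [])
    ≡⟨ coeff-⊛ f g m ⟩
  Σ (upTo (suc m)) (λ i → f (i ∷ []) ℤ.* g ((m ∸ i) ∷ []))
    ≡⟨ Σ-cong (upTo (suc m)) (λ i → cong₂ ℤ._*_ (f≗xᵃ i) (g≗xᵇ (m ∸ i))) ⟩
  Σ (upTo (suc m)) (λ i → δ a i ℤ.* δ b (m ∸ i))
    ≡⟨ Σ-δ-convolution a b m ⟩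
  δ (a ℕ.+ b) m ∎

𝟙-monomial : 𝟙 ≗x^ 0
𝟙-monomial .coeff zero    = refl
𝟙-monomial .coeff (suc _) = refl

X-monomial : X Fin.zero ≗x^ 1
X-monomial .coeff zero          = refl
X-monomial .coeff (suc zero)    = refl
X-monomial .coeff (suc (suc _)) = refl

^-monomial : ∀ {f a} → f ≗x^ a → ∀ p → f ^ p ≗x^ p * a
^-monomial f≗xᵃ zero    = 𝟙-monomial
^-monomial f≗xᵃ (suc p) = ⊛-monomial f≗xᵃ (^-monomial f≗xᵃ p)

Xⁿ-monomial : ∀ n → X Fin.zero ^ n ≗x^ n
Xⁿ-monomial zero    = 𝟙-monomial
Xⁿ-monomial (suc n) = ⊛-monomial X-monomial (Xⁿ-monomial n)

powerSum-monomial : ∀ n → powerSum 1 n ≗x^ n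
powerSum-monomial n .coeff b = trans (+-identityʳ _) (coeff (Xⁿ-monomial n) b)

gpℓ-one-variable : ∀ p ℓ → gpℓ 1 p ℓ ≗ 𝟘
gpℓ-one-variable p ℓ = divBy-𝟘 difference≗0 p
  where
  difference≗0 : powerSum 1 ℓ ^ p ⊖ powerSum 1 (p * ℓ) ≗ 𝟘
  difference≗0 (b ∷ []) =
    trans (cong₂ ℤ._-_ (coeff (^-monomial (powerSum-monomial ℓ) p) b) (coeff (powerSum-monomial (p * ℓ)) b))
          (+-inverseʳ (δ (p * ℓ) b))

e₁-monomial : e 1 ≗x^ 1
e₁-monomial .coeff zero          = refl
e₁-monomial .coeff (suc zero)    = refl
e₁-monomial .coeff (suc (suc _)) = refl

e-one-variable : ∀ {k} → 2 ≤ k → e {1} k ≗ 𝟘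
e-one-variable (s≤s (s≤s _)) (zero ∷ [])        = refl
e-one-variable (s≤s (s≤s _)) (suc zero ∷ [])    = refl
e-one-variable (s≤s (s≤s _)) (suc (suc _) ∷ []) = refl

eP-ones-monomial : ∀ n → eP (replicate n 1) ≗x^ n
eP-ones-monomial zero    = 𝟙-monomial
eP-ones-monomial (suc n) = ⊛-monomial e₁-monomial (eP-ones-monomial n)

eP-one-variable : ∀ {λs} → Any (2 ≤_) λs → eP {1} λs ≗ 𝟘
eP-one-variable {k ∷ λs} (here 2≤k)  = ⊛-zeroˡ (eP λs) (e-one-variable 2≤k)
eP-one-variable {k ∷ λs} (there any) = ⊛-zeroʳ (e k) (eP-one-variable any)

-- parts fuel n (suc k) always contains (1,…,1), because 1 ≤ suc k.
Σ-parts : ∀ fuel n k (g : List ℕ → ℤ) → (∀ λs → Any (2 ≤_) λs → g λs ≡ + 0) → n ≤ fuel →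
          Σ (parts fuel n (suc k)) g ≡ g (replicate n 1)
Σ-parts fuel zero k g g≗0 _ = +-identityʳ (g [])
Σ-parts (suc fuel) (suc n) k g g≗0 (s≤s n≤fuel) = begin
  Σ (parts (suc fuel) (suc n) (suc k)) g
    ≡⟨ Σ-concatMap (λ j → map (j ∷_) (tails j)) (map suc (upTo (suc (k ⊓ n)))) g ⟩
  Σ (map suc (upTo (suc (k ⊓ n)))) (λ j → Σ (map (j ∷_) (tails j)) g)
    ≡⟨ Σ-map suc (upTo (suc (k ⊓ n))) (λ j → Σ (map (j ∷_) (tails j)) g) ⟩
  Σ (upTo (suc (k ⊓ n))) (λ i → Σ (map (suc i ∷_) (tails (suc i))) g)
    ≡⟨ Σ-upTo-suc (k ⊓ n) (λ i → Σ (map (suc i ∷_) (tails (suc i))) g) ⟩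
  Σ (map (1 ∷_) (tails 1)) g + Σ (upTo (k ⊓ n)) (λ i → Σ (map (2 ℕ.+ i ∷_) (tails (2 ℕ.+ i))) g)
    ≡⟨ cong₂ _+_ headOne (Σ-zero (upTo (k ⊓ n)) headAbove1) ⟩
  g (1 ∷ replicate n 1) + + 0
    ≡⟨ +-identityʳ _ ⟩
  g (replicate (suc n) 1) ∎
  where
  tails : ℕ → List (List ℕ)
  tails j = parts fuel (suc n ∸ j) j

  headOne : Σ (map (1 ∷_) (tails 1)) g ≡ g (1 ∷ replicate n 1)
  headOne = trans (Σ-map (1 ∷_) (tails 1) g)
                  (Σ-parts fuel n 0 (g ∘ (1 ∷_)) (λ λs any → g≗0 (1 ∷ λs) (there any)) n≤fuel)

  headAbove1 : ∀ i → Σ (map (2 ℕ.+ i ∷_) (tails (2 ℕ.+ i))) g ≡ + 0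
  headAbove1 i = trans (Σ-map (2 ℕ.+ i ∷_) (tails (2 ℕ.+ i)) g)
                       (Σ-zero (tails (2 ℕ.+ i)) (λ λs → g≗0 (2 ℕ.+ i ∷ λs) (here (s≤s (s≤s z≤n)))))

Σ-partitions : ∀ n (g : List ℕ → ℤ) → (∀ λs → Any (2 ≤_) λs → g λs ≡ + 0) →
               Σ (partitions n) g ≡ g (replicate n 1)
Σ-partitions zero    g g≗0 = +-identityʳ (g [])
Σ-partitions (suc n) g g≗0 = Σ-parts (suc n) (suc n) n g g≗0 ≤-refl

lemma4p1 : (p ℓ : ℕ) → Prime p → ℓ > 0 → (c : List ℕ → ℤ)
         → (∀ N m → gpℓ N p ℓ m ≡ sumPartitions N (p * ℓ) c m)
         → c (replicate (p * ℓ) 1) ≡ + 0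
lemma4p1 p ℓ _ _ c expansion = begin
  c ones
    ≡⟨ sym (*-identityʳ (c ones)) ⟩
  c ones ℤ.* + 1
    ≡⟨ cong (c ones ℤ.*_) (sym (trans (coeff (eP-ones-monomial n) n) (δ-refl n))) ⟩
  c ones ℤ.* eP ones (n ∷ [])
    ≡⟨ sym (Σ-partitions n coeffₙ coeffₙ-vanishes) ⟩
  Σ (partitions n) coeffₙ
    ≡⟨ sym (coeff-foldr-⊕ (λ λs → c λs · eP λs) (partitions n) (n ∷ [])) ⟩
  sumPartitions 1 n c (n ∷ [])
    ≡⟨ sym (expansion 1 (n ∷ [])) ⟩
  gpℓ 1 p ℓ (n ∷ [])
    ≡⟨ gpℓ-one-variable p ℓ (n ∷ []) ⟩
  + 0 ∎
  where
  n : ℕ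
  n = p * ℓ

  ones : List ℕ
  ones = replicate n 1

  coeffₙ : List ℕ → ℤ
  coeffₙ λs = c λs ℤ.* eP λs (n ∷ [])

  coeffₙ-vanishes : ∀ λs → Any (2 ≤_) λs → coeffₙ λs ≡ + 0
  coeffₙ-vanishes λs any = trans (cong (c λs ℤ.*_) (eP-one-variable any (n ∷ []))) (*-zeroʳ (c λs))
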